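{- Let $G$ be a finite simple graph and $H\subseteq V(G)$. If $H$ is $0_2$-invoking in $G$, then so is $V(G)\setminus H$.
   Context: Diffusion on a finite simple graph $G$: a configuration assigns an integer stack size $|v|$ to each vertex. Firing a configuration $C$ changes each vertex $v$ simultaneously from $|v|^C$ to $|v|^C + |\{u\in N(v): |u|^C>|v|^C\}| - |\{u\in N(v): |u|^C<|v|^C\}|$. The 0-configuration has every stack size $0$. A perturbation of $H\subseteq V(G)$ from the 0-configuration is the step in which every vertex of $H$ sends one chip to each of its neighbours. $H$ is $0_2$-invoking if the perturbation of $H$ from the 0-configuration followed by one ordinary firing yields the 0-configuration. -}

module Defs where

open import Data.Nat using (ℕ; zero; suc)
open import Data.Bool using (Bool; true; false; if_then_else_; not; _∧_)
open import Data.Fin using (Fin)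
open import Data.Integer using (ℤ; +_; _+_; _-_; _<?_; _≟_)
open import Data.List using (List; filterᵇ; length)
open import Data.List.Base using (allFin)
open import Relation.Nullary.Decidable using (does)
open import Relation.Binary.PropositionalEquality using (_≡_)
open import Data.Product using (_×_)

record SimpleGraph (n : ℕ) : Set where
  field
    adj       : Fin n → Fin n → Bool
    symmetric : ∀ u v → adj u v ≡ adj v u
    loopless  : ∀ v → adj v v ≡ false
open SimpleGraph public

-- Configurations: integer stack sizes at each vertex.
Config : ℕ → Set
Config n = Fin n → ℤ

VSubset : ℕ → Set
VSubset n = Fin n → Bool

count : {n : ℕ} → (Fin n → Bool) → ℕ
count {n} p = length (filterᵇ p (allFin n))

countNbr : {n : ℕ} → SimpleGraph n → Fin n → (Fin n → Bool) → ℕ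
countNbr G v p = count (λ u → adj G v u ∧ p u)

degree : {n : ℕ} → SimpleGraph n → Fin n → ℕ
degree G v = countNbr G v (λ _ → true)

fire : {n : ℕ} → SimpleGraph n → Config n → Config n
fire G C v =
  (C v + + countNbr G v (λ u → does (C v <? C u)))
       - + countNbr G v (λ u → does (C u <? C v))

zeroConfig : {n : ℕ} → Config n
zeroConfig _ = + 0

-- Perturbation of H from the 0-configuration: every vertex of H sends one
-- chip to each of its neighbours.
perturb : {n : ℕ} → SimpleGraph n → VSubset n → Config n
perturb G H v =
  + countNbr G v H - (if H v then + degree G v else + 0)

Invoking0₂ : {n : ℕ} → SimpleGraph n → VSubset n → Set
Invoking0₂ G H = ∀ v → fire G (perturb G H) v ≡ + 0

complement : {n : ℕ} → VSubset n → VSubset n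
complement H v = not (H v)

-- Negating every stack size commutes with firing, since it only swaps the
-- roles of richer and poorer neighbours. Perturbing V(G) \ H from the
-- 0-configuration yields exactly the negation of perturbing H: a vertex
-- gains a chip from each neighbour in one set and sends one to each
-- neighbour in the other, and these neighbour counts add up to its degree.
-- Hence firing the perturbation of V(G) \ H gives − 0 = 0 wherever firing
-- the perturbation of H gives 0.
module Submission where

open import Data.Nat using (ℕ)
open import Defs

import Data.Nat as ℕ
open import Data.Nat.Properties using (+-suc)
open import Data.Bool using (Bool; true; false; not; _∧_; T)
open import Data.Bool.Properties using (∧-identityʳ)
open import Data.Integer using (+_; _+_; _-_; -_; _<?_)
open import Data.Integer.Properties using (neg-mono-<; neg-cancel-<; pos-+)
open import Data.Integer.Tactic.RingSolver using (solve-∀)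
open import Data.List using (List; []; _∷_; filterᵇ; length)
open import Data.List.Base using (allFin)
open import Data.List.Properties using (filter-≐)
open import Data.Product using (_,_)
open import Function.Bundles using (mk⇔)
open import Relation.Binary.PropositionalEquality
open import Relation.Nullary.Decidable using (does; does-⇔)

module _ {a} {A : Set a} where

  length-filterᵇ-cong : {p q : A → Bool} → (∀ x → p x ≡ q x) → (xs : List A) →
    length (filterᵇ p xs) ≡ length (filterᵇ q xs)
  length-filterᵇ-cong p≗q xs =
    cong length (filter-≐ _ _ ((λ {x} → subst T (p≗q x)) , (λ {x} → subst T (sym (p≗q x)))) xs)

  length-filterᵇ-split : (p q : A → Bool) (xs : List A) →
    length (filterᵇ (λ x → p x ∧ not (q x)) xs) ℕ.+ length (filterᵇ (λ x → p x ∧ q x) xs)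
      ≡ length (filterᵇ p xs)
  length-filterᵇ-split p q [] = refl
  length-filterᵇ-split p q (x ∷ xs) with p x | q x
  ... | false | _     = length-filterᵇ-split p q xs
  ... | true  | true  = trans (+-suc _ _) (cong ℕ.suc (length-filterᵇ-split p q xs))
  ... | true  | false = cong ℕ.suc (length-filterᵇ-split p q xs)

does-neg-<? : ∀ i j → does (- i <? - j) ≡ does (j <? i)
does-neg-<? i j = does-⇔ (mk⇔ neg-cancel-< neg-mono-<) (- i <? - j) (j <? i)

countNbr-complement+countNbr : ∀ {n} (G : SimpleGraph n) (H : VSubset n) v →
  countNbr G v (complement H) ℕ.+ countNbr G v H ≡ degree G v
countNbr-complement+countNbr {n} G H v =
  trans (length-filterᵇ-split (adj G v) H (allFin n))
        (length-filterᵇ-cong (λ u → sym (∧-identityʳ (adj G v u))) (allFin n))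

perturb-complement : ∀ {n} (G : SimpleGraph n) (H : VSubset n) v →
  perturb G (complement H) v ≡ - perturb G H v
perturb-complement G H v
  rewrite sym (countNbr-complement+countNbr G H v)
        | pos-+ (countNbr G v (complement H)) (countNbr G v H)
  with H v
... | true  = lemma (+ countNbr G v (complement H)) (+ countNbr G v H)
  where
  lemma : ∀ c h → c - + 0 ≡ - (h - (c + h))
  lemma = solve-∀
... | false = lemma (+ countNbr G v (complement H)) (+ countNbr G v H)
  where
  lemma : ∀ c h → c - (c + h) ≡ - (h - + 0)
  lemma = solve-∀

fire-negate : ∀ {n} (G : SimpleGraph n) (C C′ : Config n) → (∀ u → C′ u ≡ - C u) →
  ∀ v → fire G C′ v ≡ - fire G C v
fire-negate {n} G C C′ C′≡-C v = begin
  (C′ v + + richer′) - + poorer′  ≡⟨ cong₂ (λ x y → (x + + y) - + poorer′) (C′≡-C v) richer′≡poorer ⟩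
  (- C v + + poorer) - + poorer′  ≡⟨ cong (λ y → (- C v + + poorer) - + y) poorer′≡richer ⟩
  (- C v + + poorer) - + richer   ≡⟨ negate-swap (C v) (+ poorer) (+ richer) ⟩
  - ((C v + + richer) - + poorer) ∎
  where
  open ≡-Reasoning
  richer  = countNbr G v (λ u → does (C v <? C u))
  poorer  = countNbr G v (λ u → does (C u <? C v))
  richer′ = countNbr G v (λ u → does (C′ v <? C′ u))
  poorer′ = countNbr G v (λ u → does (C′ u <? C′ v))

  negate-swap : ∀ x a b → (- x + a) - b ≡ - ((x + b) - a)
  negate-swap = solve-∀

  richer′≡poorer : richer′ ≡ poorer
  richer′≡poorer = length-filterᵇ-cong (λ u → cong (adj G v u ∧_)
    (trans (cong₂ (λ x y → does (x <? y)) (C′≡-C v) (C′≡-C u)) (does-neg-<? (C v) (C u))))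
    (allFin n)

  poorer′≡richer : poorer′ ≡ richer
  poorer′≡richer = length-filterᵇ-cong (λ u → cong (adj G v u ∧_)
    (trans (cong₂ (λ x y → does (x <? y)) (C′≡-C u) (C′≡-C v)) (does-neg-<? (C u) (C v))))
    (allFin n)

mainTheorem2 : (n : ℕ) (G : SimpleGraph n) (H : VSubset n) →
    Invoking0₂ G H → Invoking0₂ G (complement H)
mainTheorem2 n G H invoking v = begin
  fire G (perturb G (complement H)) v  ≡⟨ fire-negate G (perturb G H) _ (perturb-complement G H) v ⟩
  - fire G (perturb G H) v             ≡⟨ cong -_ (invoking v) ⟩
  + 0                                  ∎
  where open ≡-Reasoning
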